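{- Let $\pi$ and $\sigma$ be permutations such that $\pi\le\sigma$ ($\pi$ is a pattern of $\sigma$). Then $\mathcal{L}_\sigma\subseteq\mathcal{L}_\pi$.
   Context: Pattern: $\pi$ of size $k$ is a pattern of $\sigma$ if some subsequence $\sigma_{i_1}\cdots\sigma_{i_k}$, $i_1<\dots<i_k$, is order-isomorphic to $\pi$. Pin words: a pin representation of a permutation is a sequence of points $(p_1,\dots,p_n)$, no two on a common horizontal or vertical line, order-isomorphic to the permutation's diagram $\{(i,\pi_i)\}$, where each $p_i$ ($i\ge2$) lies outside the bounding box (smallest axis-parallel rectangle) of $\{p_1,\dots,p_{i-1}\}$ and either separates $p_{i-1}$ from $\{p_1,\dots,p_{i-2}\}$ (the horizontal or vertical line through $p_i$ has them on opposite sides) or separates no two nonempty subsets of $\{p_1,\dots,p_{i-1}\}$. Choosing an origin $p_0$ such that $(p_0,\dots,p_n)$ satisfies the same conditions, encode $p_i$ ($i\ge1$) by $U/D/L/R$ if $p_i$ separates $p_{i-1}$ from $\{p_0,\dots,p_{i-2}\}$ from the top/bottom/left/right, and by $1/2/3/4$ if $p_i$ separates no two nonempty subsets of $\{p_0,\dots,p_{i-1}\}$ and lies up-right/up-left/bottom-left/bottom-right of their bounding box. $P(\pi)$ is the set of all words so obtained for $\pi$ (pin words; empty if $\pi$ has no pin representation). A strict pin word is a numeral followed only by directions ($U,D,L,R$). Cutting a pin word $u$ before each numeral gives its strong numeral-led factor decomposition $u=u^{(1)}\cdots u^{(j)}$. With $A=\{U,D,L,R\}$, $\phi$ maps a strict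 pin word $u=u'u''$, $|u'|=2$, to $\varphi(u')u''$ with $\varphi$: $1R\mapsto RUR$, $1L\mapsto RUL$, $1U\mapsto URU$, $1D\mapsto URD$, $2R\mapsto LUR$, $2L\mapsto LUL$, $2U\mapsto ULU$, $2D\mapsto ULD$, $3R\mapsto LDR$, $3L\mapsto LDL$, $3U\mapsto DLU$, $3D\mapsto DLD$, $4R\mapsto RDR$, $4L\mapsto RDL$, $4U\mapsto DRU$, $4D\mapsto DRD$, and maps single numerals to sets: $\phi(1)=\{UR,RU\}$, $\phi(2)=\{UL,LU\}$, $\phi(3)=\{DL,LD\}$, $\phi(4)=\{RD,DR\}$. Then $\mathcal{L}(u)=A^\star\phi(u^{(1)})A^\star\cdots A^\star\phi(u^{(j)})A^\star$ and $\mathcal{L}_\pi=\bigcup_{u\in P(\pi)}\mathcal{L}(u)$. -}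

module Defs where

open import Data.Nat using (ℕ; zero; suc)
open import Data.Fin using (Fin; zero; suc; toℕ; inject₁) renaming (_<_ to _<ᶠ_)
open import Data.Fin.Permutation using (Permutation′; _⟨$⟩ʳ_)
open import Data.Integer using (ℤ) renaming (_<_ to _<ℤ_)
open import Data.Product using (Σ; ∃; _×_; _,_; proj₁; proj₂)
open import Data.Sum using (_⊎_)
open import Data.List using (List; []; _∷_; _++_)
open import Data.Vec using (Vec; lookup; toList)
open import Relation.Binary.PropositionalEquality using (_≡_; _≢_)
open import Relation.Nullary using (¬_)

_≼_ : ∀ {k n} → Permutation′ k → Permutation′ n → Set
_≼_ {k} {n} π σ =
  Σ (Fin k → Fin n) λ ι →
    (∀ a b → a <ᶠ b → ι a <ᶠ ι b) ×
    (∀ a b → (σ ⟨$⟩ʳ ι a <ᶠ σ ⟨$⟩ʳ ι b → π ⟨$⟩ʳ a <ᶠ π ⟨$⟩ʳ b) ×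
             (π ⟨$⟩ʳ a <ᶠ π ⟨$⟩ʳ b → σ ⟨$⟩ʳ ι a <ᶠ σ ⟨$⟩ʳ ι b))

-- Points in the plane (integer coordinates suffice: everything only
-- depends on the relative order of coordinates)

Point : Set
Point = ℤ × ℤ

xc : Point → ℤ
xc = proj₁

yc : Point → ℤ
yc = proj₂

module _ {m : ℕ} (r : Fin m → Point) where

  Distinct : Set
  Distinct = ∀ i j → i ≢ j → (xc (r i) ≢ xc (r j)) × (yc (r i) ≢ yc (r j))

  AllLeftOf AllRightOf AllBelow AllAbove : Fin m → Set
  AllLeftOf  i = ∀ j → j <ᶠ i → xc (r j) <ℤ xc (r i)
  AllRightOf i = ∀ j → j <ᶠ i → xc (r i) <ℤ xc (r j)
  AllBelow   i = ∀ j → j <ᶠ i → yc (r j) <ℤ yc (r i)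
  AllAbove   i = ∀ j → j <ᶠ i → yc (r i) <ℤ yc (r j)

  OutsideBox : Fin m → Set
  OutsideBox i = AllLeftOf i ⊎ AllRightOf i ⊎ AllBelow i ⊎ AllAbove i

  -- r i separates r k (the previous point) from the nonempty set
  -- {r j | j < k} by its horizontal or vertical line
  Separates : Fin m → Fin m → Set
  Separates k i =
    (Σ (Fin m) λ j → j <ᶠ k) ×
    (  ((yc (r k) <ℤ yc (r i)) × (∀ j → j <ᶠ k → yc (r i) <ℤ yc (r j)))
     ⊎ ((yc (r i) <ℤ yc (r k)) × (∀ j → j <ᶠ k → yc (r j) <ℤ yc (r i)))
     ⊎ ((xc (r k) <ℤ xc (r i)) × (∀ j → j <ᶠ k → xc (r i) <ℤ xc (r j)))
     ⊎ ((xc (r i) <ℤ xc (r k)) × (∀ j → j <ᶠ k → xc (r j) <ℤ xc (r i))))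

  -- neither the horizontal nor the vertical line through r i has points
  -- of {r j | j < i} on both sides: r i separates no two nonempty subsets
  SeparatesNothing : Fin m → Set
  SeparatesNothing i =
    (AllBelow i ⊎ AllAbove i) × (AllLeftOf i ⊎ AllRightOf i)

  PinConditions : Set
  PinConditions =
    Distinct ×
    (∀ k i → toℕ i ≡ suc (toℕ k) →
       OutsideBox i × (Separates k i ⊎ SeparatesNothing i))

data Dir : Set where
  U D L R : Dir

data Num : Set where
  n1 n2 n3 n4 : Num

data Letter : Set where
  dir : Dir → Letter
  num : Num → Letter

module _ {m : ℕ} (r : Fin m → Point) where

  -- encoding of the point r i, where k is the index of the previous point
  data Code (k i : Fin m) : Letter → Set where
    cU : Separates r k i → AllBelow r i   → Code k i (dir U)
    cD : Separates r k i → AllAbove r i   → Code k i (dir D)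
    cL : Separates r k i → AllRightOf r i → Code k i (dir L)
    cR : Separates r k i → AllLeftOf r i  → Code k i (dir R)
    c1 : SeparatesNothing r i → AllLeftOf r i  → AllBelow r i → Code k i (num n1)
    c2 : SeparatesNothing r i → AllRightOf r i → AllBelow r i → Code k i (num n2)
    c3 : SeparatesNothing r i → AllRightOf r i → AllAbove r i → Code k i (num n3)
    c4 : SeparatesNothing r i → AllLeftOf r i  → AllAbove r i → Code k i (num n4)

withOrigin : ∀ {n} → Point → (Fin n → Point) → Fin (suc n) → Point
withOrigin p0 p zero    = p0
withOrigin p0 p (suc t) = p t

-- the points p (as a set) are order-isomorphic to the diagram {(i, π i)}:
-- point p t corresponds to the diagram point (f t, π (f t))
OrderIso : ∀ {n} → (Fin n → Point) → Permutation′ n → Set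
OrderIso {n} p π =
  Σ (Fin n → Fin n) λ f → ∀ s t →
    ((xc (p s) <ℤ xc (p t) → f s <ᶠ f t) × (f s <ᶠ f t → xc (p s) <ℤ xc (p t))) ×
    ((yc (p s) <ℤ yc (p t) → π ⟨$⟩ʳ f s <ᶠ π ⟨$⟩ʳ f t) ×
     (π ⟨$⟩ʳ f s <ᶠ π ⟨$⟩ʳ f t → yc (p s) <ℤ yc (p t)))

IsPinWord : ∀ {n} → Permutation′ n → Vec Letter n → Set
IsPinWord {n} π w =
  Σ (Fin n → Point) λ p → Σ Point λ p0 →
    PinConditions p × OrderIso p π ×
    PinConditions (withOrigin p0 p) ×
    (∀ t → Code (withOrigin p0 p) (inject₁ t) (suc t) (lookup w t))

-- The first component
-- collects directions preceding the first numeral (empty for pin words).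
decompose : List Letter → List Dir × List (Num × List Dir)
decompose [] = [] , []
decompose (dir d ∷ w) with decompose w
... | ds , fs = d ∷ ds , fs
decompose (num a ∷ w) with decompose w
... | ds , fs = [] , (a , ds) ∷ fs

factors : List Letter → List (Num × List Dir)
factors w = proj₂ (decompose w)

φ₂ : Num → Dir → List Dir
φ₂ n1 R = R ∷ U ∷ R ∷ []
φ₂ n1 L = R ∷ U ∷ L ∷ []
φ₂ n1 U = U ∷ R ∷ U ∷ []
φ₂ n1 D = U ∷ R ∷ D ∷ []
φ₂ n2 R = L ∷ U ∷ R ∷ []
φ₂ n2 L = L ∷ U ∷ L ∷ []
φ₂ n2 U = U ∷ L ∷ U ∷ []
φ₂ n2 D = U ∷ L ∷ D ∷ []
φ₂ n3 R = L ∷ D ∷ R ∷ []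
φ₂ n3 L = L ∷ D ∷ L ∷ []
φ₂ n3 U = D ∷ L ∷ U ∷ []
φ₂ n3 D = D ∷ L ∷ D ∷ []
φ₂ n4 R = R ∷ D ∷ R ∷ []
φ₂ n4 L = R ∷ D ∷ L ∷ []
φ₂ n4 U = D ∷ R ∷ U ∷ []
φ₂ n4 D = D ∷ R ∷ D ∷ []

φ₁ : Num → List Dir → Set
φ₁ n1 v = (v ≡ U ∷ R ∷ []) ⊎ (v ≡ R ∷ U ∷ [])
φ₁ n2 v = (v ≡ U ∷ L ∷ []) ⊎ (v ≡ L ∷ U ∷ [])
φ₁ n3 v = (v ≡ D ∷ L ∷ []) ⊎ (v ≡ L ∷ D ∷ [])
φ₁ n4 v = (v ≡ R ∷ D ∷ []) ⊎ (v ≡ D ∷ R ∷ [])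

InΦ : Num × List Dir → List Dir → Set
InΦ (a , [])     v = φ₁ a v
InΦ (a , d ∷ ds) v = v ≡ φ₂ a d ++ ds

data Matches : List Dir → List (Num × List Dir) → Set where
  done : ∀ w → Matches w []
  step : ∀ a b c f fs → InΦ f b → Matches c fs → Matches (a ++ b ++ c) (f ∷ fs)

InL : List Letter → List Dir → Set
InL u w = Matches w (factors u)

InLπ : ∀ {n} → Permutation′ n → List Dir → Set
InLπ {n} π w = Σ (Vec Letter n) λ u → IsPinWord π u × InL (toList u) w

module Submission where

open import Defs
open import Data.Nat as ℕ using (ℕ; zero; suc; z≤n; s≤s)
import Data.Nat.Properties as ℕP
open import Data.Fin using (Fin; zero; suc; toℕ; inject₁; punchIn; punchOut; fromℕ<)
  renaming (_<_ to _<ᶠ_)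
import Data.Fin.Properties as FP
open import Data.Fin.Permutation using (Permutation′; _⟨$⟩ʳ_)
open import Data.Integer using (ℤ) renaming (_<_ to _<ℤ_)
import Data.Integer.Properties as ℤP
open import Data.Product using (Σ; _×_; _,_; proj₁; proj₂)
open import Data.Sum using (_⊎_; inj₁; inj₂) renaming (map to map⊎; swap to swap⊎)
open import Data.Empty using (⊥; ⊥-elim)
open import Data.Unit using (⊤; tt)
open import Data.Maybe using (Maybe; just; nothing)
open import Data.List using (List; []; _∷_; _++_; tabulate; head)
open import Data.List.Properties using (++-assoc; ++-identityʳ)
open import Data.Vec using (Vec; lookup; toList)
import Data.Vec as Vec
import Data.Vec.Properties as VecP
open import Function using (flip; _∘_)
open import Relation.Binary.PropositionalEquality
open import Relation.Binary.Structures using (IsStrictPartialOrder)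
import Relation.Binary.Construct.Flip.EqAndOrd as Flip
open import Relation.Binary.Definitions using (tri<; tri≈; tri>)
open import Relation.Nullary using (yes; no)
open import Relation.Nullary.Decidable using (¬?)

-- Take w ∈ 𝓛(u) for a pin word u of σ with
-- pin representation p, and delete, one at a time, the points of p outside
-- the copy of π.  Deleting a point keeps the pin conditions (module
-- DeletePoint): consecutive points stay consecutive, except that the point
-- after the deleted one now separates nothing.  So the pin word changes
-- locally (module DeleteFromPinWord): the deleted letter disappears, and if
-- the next letter is a direction the two letters merge into the numeral of
-- the quadrant the next point now lies in (relation Deletion).  Every
-- Deletion satisfies 𝓛(u) ⊆ 𝓛(u') (deletion-sound), since each word of φ of
-- an old factor contains a word of φ of the new one.  When only the copy is
-- left we have a pin word of π whose language contains w (module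
-- Reduction).

data Vertical : Dir → Set where
  up   : Vertical U
  down : Vertical D

data Horizontal : Dir → Set where
  left  : Horizontal L
  right : Horizontal R

axis : ∀ d → Vertical d ⊎ Horizontal d
axis U = inj₁ up
axis D = inj₁ down
axis L = inj₂ left
axis R = inj₂ right

-- Two directions form a turn when they lie on different axes.  In a pin
-- word two consecutive directions always turn (lemma directions-turn).
data Turn (x y : Dir) : Set where
  vh : Vertical x → Horizontal y → Turn x y
  hv : Horizontal x → Vertical y → Turn x y

corner : Dir → Dir → Num
corner U R = n1
corner U L = n2
corner D L = n3
corner D R = n4
corner _ _ = n1

-- The numeral of the quadrant spanned by the two directions of a turn
-- (its value on non-turns is irrelevant).
quadrant : Dir → Dir → Num
quadrant U y = corner U y
quadrant D y = corner D y
quadrant L y = corner y L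
quadrant R y = corner y R

vertical horizontal : Num → Dir
vertical n1 = U
vertical n2 = U
vertical n3 = D
vertical n4 = D
horizontal n1 = R
horizontal n2 = L
horizontal n3 = L
horizontal n4 = R

vertical-is : ∀ a → Vertical (vertical a)
vertical-is n1 = up
vertical-is n2 = up
vertical-is n3 = down
vertical-is n4 = down

horizontal-is : ∀ a → Horizontal (horizontal a)
horizontal-is n1 = right
horizontal-is n2 = left
horizontal-is n3 = left
horizontal-is n4 = right

outer inner : Num → Dir → Dir
outer a U = vertical a
outer a D = vertical a
outer a L = horizontal a
outer a R = horizontal a
inner a U = horizontal a
inner a D = horizontal a
inner a L = vertical a
inner a R = vertical a

φ₂-shape : ∀ a y → φ₂ a y ≡ outer a y ∷ inner a y ∷ y ∷ []
φ₂-shape n1 = λ { U → refl ; D → refl ; L → refl ; R → refl }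
φ₂-shape n2 = λ { U → refl ; D → refl ; L → refl ; R → refl }
φ₂-shape n3 = λ { U → refl ; D → refl ; L → refl ; R → refl }
φ₂-shape n4 = λ { U → refl ; D → refl ; L → refl ; R → refl }

φ₁-vertical-first : ∀ a → φ₁ a (vertical a ∷ horizontal a ∷ [])
φ₁-vertical-first n1 = inj₁ refl
φ₁-vertical-first n2 = inj₁ refl
φ₁-vertical-first n3 = inj₁ refl
φ₁-vertical-first n4 = inj₂ refl

φ₁-horizontal-first : ∀ a → φ₁ a (horizontal a ∷ vertical a ∷ [])
φ₁-horizontal-first n1 = inj₂ refl
φ₁-horizontal-first n2 = inj₂ refl
φ₁-horizontal-first n3 = inj₂ refl
φ₁-horizontal-first n4 = inj₁ refl

φ₁-outer-inner : ∀ a y → φ₁ a (outer a y ∷ inner a y ∷ [])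
φ₁-outer-inner a U = φ₁-vertical-first a
φ₁-outer-inner a D = φ₁-vertical-first a
φ₁-outer-inner a L = φ₁-horizontal-first a
φ₁-outer-inner a R = φ₁-horizontal-first a

inner-turn : ∀ a y → Turn (inner a y) y
inner-turn a U = hv (horizontal-is a) up
inner-turn a D = hv (horizontal-is a) down
inner-turn a L = vh (vertical-is a) left
inner-turn a R = vh (vertical-is a) right

φ₁-quadrant : ∀ {x y} → Turn x y → φ₁ (quadrant x y) (x ∷ y ∷ [])
φ₁-quadrant (vh up left)    = inj₁ refl
φ₁-quadrant (vh up right)   = inj₁ refl
φ₁-quadrant (vh down left)  = inj₁ refl
φ₁-quadrant (vh down right) = inj₂ refl
φ₁-quadrant (hv left up)    = inj₂ refl
φ₁-quadrant (hv left down)  = inj₂ refl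
φ₁-quadrant (hv right up)   = inj₂ refl
φ₁-quadrant (hv right down) = inj₁ refl

φ₂-quadrant : ∀ {x y z} → Turn x y → Turn y z → φ₂ (quadrant x y) z ≡ x ∷ y ∷ z ∷ []
φ₂-quadrant (vh up left)    (hv _ up)    = refl
φ₂-quadrant (vh up left)    (hv _ down)  = refl
φ₂-quadrant (vh up right)   (hv _ up)    = refl
φ₂-quadrant (vh up right)   (hv _ down)  = refl
φ₂-quadrant (vh down left)  (hv _ up)    = refl
φ₂-quadrant (vh down left)  (hv _ down)  = refl
φ₂-quadrant (vh down right) (hv _ up)    = refl
φ₂-quadrant (vh down right) (hv _ down)  = refl
φ₂-quadrant (hv left up)    (vh _ left)  = refl
φ₂-quadrant (hv left up)    (vh _ right) = refl
φ₂-quadrant (hv left down)  (vh _ left)  = refl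
φ₂-quadrant (hv left down)  (vh _ right) = refl
φ₂-quadrant (hv right up)   (vh _ left)  = refl
φ₂-quadrant (hv right up)   (vh _ right) = refl
φ₂-quadrant (hv right down) (vh _ left)  = refl
φ₂-quadrant (hv right down) (vh _ right) = refl

-- The directions of a word before its first numeral; for a word
-- following a numeral a they extend the factor led by a.
leading : List Letter → List Dir
leading u = proj₁ (decompose u)

NumeralLed : List Letter → Set
NumeralLed []          = ⊤
NumeralLed (num _ ∷ _) = ⊤
NumeralLed (dir _ ∷ _) = ⊥

leading-numeralLed : ∀ u → NumeralLed u → leading u ≡ []
leading-numeralLed []          _ = refl
leading-numeralLed (num _ ∷ _) _ = refl

TurnsInto : Dir → Maybe Letter → Set
TurnsInto y (just (dir z)) = Turn y z
TurnsInto y _              = ⊤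

-- Deleting a point of a pin
-- representation erases its letter; if the next letter is a direction,
-- the next point no longer separates anything and the pair of letters
-- becomes the numeral of the quadrant the next point now lies in.
data Deletion : List Letter → List Letter → Set where
  keep          : ∀ x {u u'} → Deletion u u' → Deletion (x ∷ u) (x ∷ u')
  dropNumeral   : ∀ a u → NumeralLed u → Deletion (num a ∷ u) u
  dropDirection : ∀ x u → NumeralLed u → Deletion (dir x ∷ u) u
  mergeNumeral  : ∀ a y u → TurnsInto y (head u) →
                  Deletion (num a ∷ dir y ∷ u) (num (quadrant (inner a y) y) ∷ u)
  mergeTurn     : ∀ x y u → Turn x y → TurnsInto y (head u) →
                  Deletion (dir x ∷ dir y ∷ u) (num (quadrant x y) ∷ u)

_⊒_ : Num × List Dir → Num × List Dir → Set
f ⊒ f' = ∀ b → InΦ f b →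
  Σ (List Dir) λ b₁ → Σ (List Dir) λ b₂ → Σ (List Dir) λ b₃ →
    (b ≡ b₁ ++ b₂ ++ b₃) × InΦ f' b₂

SplitsInto : Num × List Dir → Num × List Dir → Num × List Dir → Set
SplitsInto f f₁ f₂ = ∀ b → InΦ f b →
  Σ (List Dir) λ b₁ → Σ (List Dir) λ b₂ → (b ≡ b₁ ++ b₂) × InΦ f₁ b₁ × InΦ f₂ b₂

matches-prepend : ∀ x {w fs} → Matches w fs → Matches (x ++ w) fs
matches-prepend x (done _) = done _
matches-prepend x {fs = f ∷ fs} (step a b c f fs ib m) =
  subst (λ v → Matches v (f ∷ fs)) (++-assoc x a (b ++ c))
        (step (x ++ a) b c f fs ib m)

matches-drop : ∀ {f F w} → Matches w (f ∷ F) → Matches w F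
matches-drop {F = F} (step a b c _ _ _ m) =
  subst (λ v → Matches v F) (++-assoc a b c) (matches-prepend (a ++ b) m)

matches-shrink : ∀ {f f' F w} → f ⊒ f' → Matches w (f ∷ F) → Matches w (f' ∷ F)
matches-shrink {f' = f'} {F} sub (step a b c _ _ ib m)
  with b₁ , b₂ , b₃ , refl , ib' ← sub b ib =
  subst (λ v → Matches v (f' ∷ F)) regroup
        (step (a ++ b₁) b₂ (b₃ ++ c) f' F ib' (matches-prepend b₃ m))
  where
  regroup : (a ++ b₁) ++ b₂ ++ b₃ ++ c ≡ a ++ (b₁ ++ b₂ ++ b₃) ++ c
  regroup = begin
    (a ++ b₁) ++ b₂ ++ b₃ ++ c   ≡⟨ ++-assoc a b₁ _ ⟩
    a ++ b₁ ++ b₂ ++ b₃ ++ c     ≡⟨ cong (λ v → a ++ b₁ ++ v) (++-assoc b₂ b₃ c) ⟨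
    a ++ b₁ ++ (b₂ ++ b₃) ++ c   ≡⟨ cong (a ++_) (++-assoc b₁ (b₂ ++ b₃) c) ⟨
    a ++ (b₁ ++ b₂ ++ b₃) ++ c   ∎
    where open ≡-Reasoning

matches-split : ∀ {f f₁ f₂ F w} → SplitsInto f f₁ f₂ →
                Matches w (f ∷ F) → Matches w (f₁ ∷ f₂ ∷ F)
matches-split {f₁ = f₁} {f₂} {F} split (step a b c _ _ ib m)
  with b₁ , b₂ , refl , i₁ , i₂ ← split b ib =
  subst (λ v → Matches v (f₁ ∷ f₂ ∷ F)) (cong (a ++_) (sym (++-assoc b₁ b₂ c)))
        (step a b₁ (b₂ ++ c) f₁ (f₂ ∷ F) i₁ (step [] b₂ c f₂ F i₂ m))

φ-suffix : ∀ a pre x y ds b → InΦ (a , pre ++ x ∷ y ∷ ds) b →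
           Σ (List Dir) λ b₁ → (b ≡ b₁ ++ x ∷ y ∷ ds) × InΦ (a , pre) b₁
φ-suffix a []      x y ds b refl =
  outer a x ∷ inner a x ∷ [] , cong (_++ y ∷ ds) (φ₂-shape a x) , φ₁-outer-inner a x
φ-suffix a (p ∷ pre) x y ds b refl =
  φ₂ a p ++ pre , sym (++-assoc (φ₂ a p) pre (x ∷ y ∷ ds)) , refl

φ-dropLast : ∀ a pre x → (a , pre ++ x ∷ []) ⊒ (a , pre)
φ-dropLast a []        x b refl =
  [] , outer a x ∷ inner a x ∷ [] , x ∷ [] , cong (_++ []) (φ₂-shape a x) , φ₁-outer-inner a x
φ-dropLast a (p ∷ pre) x b refl =
  [] , φ₂ a p ++ pre , x ∷ [] , sym (++-assoc (φ₂ a p) pre (x ∷ [])) , refl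

φ-quadrant : ∀ {x y} u → Turn x y → TurnsInto y (head u) →
             InΦ (quadrant x y , leading u) (x ∷ y ∷ leading u)
φ-quadrant []          xy _  = φ₁-quadrant xy
φ-quadrant (num _ ∷ _) xy _  = φ₁-quadrant xy
φ-quadrant (dir z ∷ u) xy yz = sym (cong (_++ leading u) (φ₂-quadrant xy yz))

φ-mergeNumeral : ∀ a y u → TurnsInto y (head u) →
                 (a , y ∷ leading u) ⊒ (quadrant (inner a y) y , leading u)
φ-mergeNumeral a y u yu b refl =
  outer a y ∷ [] , inner a y ∷ y ∷ leading u , [] ,
  trans (cong (_++ leading u) (φ₂-shape a y))
        (cong (λ v → outer a y ∷ inner a y ∷ y ∷ v) (sym (++-identityʳ (leading u)))) ,
  φ-quadrant u (inner-turn a y) yu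

-- A deletion inside a word u that follows a numeral a and directions pre
-- (so that u contributes leading u to the factor led by a) does not
-- shrink the language: membership is transported factor by factor.
deletion-sound-after : ∀ {u u'} → Deletion u u' → ∀ a pre w →
  Matches w ((a , pre ++ leading u) ∷ factors u) →
  Matches w ((a , pre ++ leading u') ∷ factors u')
deletion-sound-after (keep (dir d) {u} {u'} del) a pre w m =
  subst (λ ds → Matches w ((a , ds) ∷ factors u')) (++-assoc pre (d ∷ []) (leading u'))
    (deletion-sound-after del a (pre ++ d ∷ []) w
      (subst (λ ds → Matches w ((a , ds) ∷ factors u)) (sym (++-assoc pre (d ∷ []) (leading u))) m))
deletion-sound-after (keep (num b) del) a pre _ (step x y c _ _ ib m) =
  step x y c _ _ ib (deletion-sound-after del b [] c m)
deletion-sound-after (dropNumeral b u nl) a pre w m rewrite leading-numeralLed u nl =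
  first-kept m
  where
  first-kept : ∀ {w f g F} → Matches w (f ∷ g ∷ F) → Matches w (f ∷ F)
  first-kept (step x y c _ _ ib m) = step x y c _ _ ib (matches-drop m)
deletion-sound-after (mergeNumeral b y u yu) a pre w (step x z c _ _ ib m) =
  step x z c _ _ ib (matches-shrink (φ-mergeNumeral b y u yu) m)
deletion-sound-after (dropDirection x u nl) a pre w m rewrite leading-numeralLed u nl
  | ++-identityʳ pre =
  matches-shrink (φ-dropLast a pre x) m
deletion-sound-after (mergeTurn x y u xy yu) a pre w m rewrite ++-identityʳ pre =
  matches-split split m
  where
  split : SplitsInto (a , pre ++ x ∷ y ∷ leading u) (a , pre) (quadrant x y , leading u)
  split b ib with b₁ , eq , i₁ ← φ-suffix a pre x y (leading u) b ib =
    b₁ , x ∷ y ∷ leading u , eq , i₁ , φ-quadrant u xy yu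

deletion-sound : ∀ {u u'} → Deletion u u' → NumeralLed u → ∀ w → InL u w → InL u' w
deletion-sound (keep (num b) del)     _ w m = deletion-sound-after del b [] w m
deletion-sound (dropNumeral b u nl)   _ w m rewrite leading-numeralLed u nl = matches-drop m
deletion-sound (mergeNumeral b y u yu) _ w m = matches-shrink (φ-mergeNumeral b y u yu) m
deletion-sound (keep (dir _) _)        ()
deletion-sound (dropDirection _ _ _)   ()
deletion-sound (mergeTurn _ _ _ _ _)   ()

-- Words of length m are handled as letter functions ℓ : Fin m → Letter,
-- read as the list tabulate ℓ.  The letter at position n, if any:
letterAt : ∀ {m} {A : Set} → (Fin m → A) → ℕ → Maybe A
letterAt {zero}  ℓ n       = nothing
letterAt {suc m} ℓ zero    = just (ℓ zero)
letterAt {suc m} ℓ (suc n) = letterAt (ℓ ∘ suc) n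

letterAt-zero : ∀ {m} {A : Set} (ℓ : Fin m → A) → letterAt ℓ 0 ≡ head (tabulate ℓ)
letterAt-zero {zero}  ℓ = refl
letterAt-zero {suc m} ℓ = refl

letterAt-lookup : ∀ {m} {A : Set} (ℓ : Fin m → A) s → letterAt ℓ (toℕ s) ≡ just (ℓ s)
letterAt-lookup {suc m} ℓ zero    = refl
letterAt-lookup {suc m} ℓ (suc s) = letterAt-lookup (ℓ ∘ suc) s

letterAt-beyond : ∀ {m} {A : Set} (ℓ : Fin m → A) n → m ℕ.≤ n → letterAt ℓ n ≡ nothing
letterAt-beyond {zero}  ℓ n       _         = refl
letterAt-beyond {suc m} ℓ (suc n) (s≤s m≤n) = letterAt-beyond (ℓ ∘ suc) n m≤n

position? : ∀ {m} n → (Σ (Fin m) λ s → toℕ s ≡ n) ⊎ (m ℕ.≤ n)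
position? {m} n with n ℕP.<? m
... | yes n<m = inj₁ (fromℕ< n<m , FP.toℕ-fromℕ< n<m)
... | no  n≮m = inj₂ (ℕP.≮⇒≥ n≮m)

-- The letters at positions j and j+1 replaced by the single letter c
-- (the letter at j erased, if j is the last position).
replaceAt : ∀ {m} {A : Set} → (Fin (suc m) → A) → Fin (suc m) → A → Fin m → A
replaceAt {suc m} ℓ zero    c zero    = c
replaceAt {suc m} ℓ zero    c (suc t) = ℓ (suc (suc t))
replaceAt {suc m} ℓ (suc j) c zero    = ℓ zero
replaceAt {suc m} ℓ (suc j) c (suc t) = replaceAt (ℓ ∘ suc) j c t

replaceAt-at : ∀ {m} {A : Set} (ℓ : Fin (suc m) → A) j c t → toℕ t ≡ toℕ j →
               replaceAt ℓ j c t ≡ c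
replaceAt-at {suc m} ℓ zero    c zero    _ = refl
replaceAt-at {suc m} ℓ (suc j) c (suc t) e = replaceAt-at (ℓ ∘ suc) j c t (ℕP.suc-injective e)

replaceAt-elsewhere : ∀ {m} {A : Set} (ℓ : Fin (suc m) → A) j c t → toℕ t ≢ toℕ j →
                      replaceAt ℓ j c t ≡ ℓ (punchIn j t)
replaceAt-elsewhere {suc m} ℓ zero    c zero    ne = ⊥-elim (ne refl)
replaceAt-elsewhere {suc m} ℓ zero    c (suc t) ne = refl
replaceAt-elsewhere {suc m} ℓ (suc j) c zero    ne = refl
replaceAt-elsewhere {suc m} ℓ (suc j) c (suc t) ne =
  replaceAt-elsewhere (ℓ ∘ suc) j c t (ne ∘ cong suc)

merged : Letter → Maybe Letter → Letter
merged x       nothing        = x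
merged x       (just (num a)) = num a
merged (dir x) (just (dir y)) = num (quadrant x y)
merged (num a) (just (dir y)) = num (quadrant (inner a y) y)

-- When merging a letter x with its successor y (followed by z) is a
-- Deletion: the directions involved must turn into their successors.
Mergeable : Letter → Maybe Letter → Maybe Letter → Set
Mergeable x       nothing        _ = ⊤
Mergeable x       (just (num a)) _ = ⊤
Mergeable (dir x) (just (dir y)) z = Turn x y × TurnsInto y z
Mergeable (num a) (just (dir y)) z = TurnsInto y z

mergeable-deletion : ∀ x y u → Mergeable x (just y) (head u) →
                     Deletion (x ∷ y ∷ u) (merged x (just y) ∷ u)
mergeable-deletion (num b) (num a) u _         = dropNumeral b (num a ∷ u) tt
mergeable-deletion (dir d) (num a) u _         = dropDirection d (num a ∷ u) tt
mergeable-deletion (dir x) (dir y) u (xy , yu) = mergeTurn x y u xy yu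
mergeable-deletion (num b) (dir y) u yu        = mergeNumeral b y u yu

deletion-at : ∀ {m} (ℓ : Fin (suc m) → Letter) j →
  Mergeable (ℓ j) (letterAt ℓ (suc (toℕ j))) (letterAt ℓ (suc (suc (toℕ j)))) →
  Deletion (tabulate ℓ) (tabulate (replaceAt ℓ j (merged (ℓ j) (letterAt ℓ (suc (toℕ j))))))
deletion-at {zero} ℓ zero _ with ℓ zero
... | num a = dropNumeral a [] tt
... | dir d = dropDirection d [] tt
deletion-at {suc m} ℓ zero legal =
  mergeable-deletion (ℓ zero) (ℓ (suc zero)) (tabulate (λ t → ℓ (suc (suc t))))
    (subst (Mergeable (ℓ zero) (just (ℓ (suc zero)))) (letterAt-zero (λ t → ℓ (suc (suc t)))) legal)
deletion-at {suc m} ℓ (suc j) legal = keep (ℓ zero) (deletion-at (ℓ ∘ suc) j legal)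

-- Geometry.  Coordinates are compared by a strict order ≺, which is
-- either < or its converse >.
StrictOrder : (ℤ → ℤ → Set) → Set
StrictOrder _≺_ = IsStrictPartialOrder _≡_ _≺_

<-order : StrictOrder _<ℤ_
<-order = ℤP.<-isStrictPartialOrder

>-order : StrictOrder (flip _<ℤ_)
>-order = Flip.isStrictPartialOrder ℤP.<-isStrictPartialOrder

along across : Dir → Point → ℤ
along U = yc
along D = yc
along L = xc
along R = xc
across U = xc
across D = xc
across L = yc
across R = yc

toward : Dir → ℤ → ℤ → Set
toward U = _<ℤ_
toward D = flip _<ℤ_
toward L = flip _<ℤ_
toward R = _<ℤ_

turn-or-parallel : ∀ x y → Turn x y ⊎ (across x ≡ across y)
turn-or-parallel x y with axis x | axis y
... | inj₁ up    | inj₁ up    = inj₂ refl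
... | inj₁ up    | inj₁ down  = inj₂ refl
... | inj₁ down  | inj₁ up    = inj₂ refl
... | inj₁ down  | inj₁ down  = inj₂ refl
... | inj₁ vx    | inj₂ hy    = inj₁ (vh vx hy)
... | inj₂ hx    | inj₁ vy    = inj₁ (hv hx vy)
... | inj₂ left  | inj₂ left  = inj₂ refl
... | inj₂ left  | inj₂ right = inj₂ refl
... | inj₂ right | inj₂ left  = inj₂ refl
... | inj₂ right | inj₂ right = inj₂ refl

module _ {m : ℕ} (r : Fin m → Point) where

  NotFirst : Fin m → Set
  NotFirst k = Σ (Fin m) λ j → j <ᶠ k

  Beyond : (Point → ℤ) → (ℤ → ℤ → Set) → Fin m → Set
  Beyond c _≺_ i = ∀ j → j <ᶠ i → c (r j) ≺ c (r i)

  -- r i lies beyond all earlier points in direction d; AllBelow r i,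
  -- AllAbove r i, AllRightOf r i and AllLeftOf r i are Extreme r i d for
  -- d = U, D, L, R.
  Extreme : Fin m → Dir → Set
  Extreme i d = Beyond (along d) (toward d) i

  -- In the coordinate c, r i lies ≺-after r k but ≺-before all points
  -- earlier than r k; Separates r k i is the disjunction of the four
  -- instances, and SeparatesAcross the two instances for one coordinate.
  SeparatesAlong : (Point → ℤ) → (ℤ → ℤ → Set) → Fin m → Fin m → Set
  SeparatesAlong c _≺_ k i = (c (r k) ≺ c (r i)) × (∀ j → j <ᶠ k → c (r i) ≺ c (r j))

  SeparatesAcross : (Point → ℤ) → Fin m → Fin m → Set
  SeparatesAcross c k i = SeparatesAlong c _<ℤ_ k i ⊎ SeparatesAlong c (flip _<ℤ_) k i

  separation-by-coordinate : ∀ {k i} → Separates r k i →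
    NotFirst k × (SeparatesAcross yc k i ⊎ SeparatesAcross xc k i)
  separation-by-coordinate (w , inj₁ s)                = w , inj₁ (inj₁ s)
  separation-by-coordinate (w , inj₂ (inj₁ s))         = w , inj₁ (inj₂ s)
  separation-by-coordinate (w , inj₂ (inj₂ (inj₁ s)))  = w , inj₂ (inj₁ s)
  separation-by-coordinate (w , inj₂ (inj₂ (inj₂ s)))  = w , inj₂ (inj₂ s)

  module _ {_≺_ : ℤ → ℤ → Set} (order : StrictOrder _≺_) (c : Point → ℤ) where
    open IsStrictPartialOrder order using (asym) renaming (trans to ≺-trans)

    beyond-separates-nothing : ∀ {k i} → k <ᶠ i → NotFirst k → Beyond c _≺_ i →
      SeparatesAlong c _≺_ k i ⊎ SeparatesAlong c (flip _≺_) k i → ⊥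
    beyond-separates-nothing k<i (j , j<k) beyond (inj₁ (_ , before)) =
      asym (before j j<k) (beyond j (ℕP.<-trans j<k k<i))
    beyond-separates-nothing k<i _ beyond (inj₂ (after , _)) = asym after (beyond _ k<i)

    separates-twice-same : ∀ {k i i₂} → k <ᶠ i →
      SeparatesAlong c _≺_ k i → SeparatesAlong c _≺_ i i₂ → ⊥
    separates-twice-same k<i (k≺i , _) (i≺i₂ , i₂≺) = asym (≺-trans k≺i i≺i₂) (i₂≺ _ k<i)

    separates-twice-opposite : ∀ {k i i₂} → k <ᶠ i → NotFirst k →
      SeparatesAlong c _≺_ k i → SeparatesAlong c (flip _≺_) i i₂ → ⊥
    separates-twice-opposite k<i (j , j<k) (_ , i≺) (i₂≺i , ≺i₂) =
      asym (≺-trans (i≺ j j<k) (≺i₂ j (ℕP.<-trans j<k k<i))) i₂≺i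

    beyond-after-separation : ∀ {J i} → NotFirst J → Beyond c _≺_ J →
      SeparatesAlong c _≺_ J i ⊎ SeparatesAlong c (flip _≺_) J i →
      ∀ t → t <ᶠ J → c (r t) ≺ c (r i)
    beyond-after-separation (j , j<J) beyond (inj₁ (J≺i , i≺)) t t<J =
      ⊥-elim (asym (≺-trans (beyond j j<J) J≺i) (i≺ j j<J))
    beyond-after-separation _ _ (inj₂ (_ , ≺i)) = ≺i

  separation-across : ∀ {k i} y → k <ᶠ i → Extreme i y → Separates r k i →
                      SeparatesAcross (across y) k i
  separation-across U k<i e s with separation-by-coordinate s
  ... | w , inj₁ sy = ⊥-elim (beyond-separates-nothing <-order yc k<i w e sy)
  ... | w , inj₂ sx = sx
  separation-across D k<i e s with separation-by-coordinate s
  ... | w , inj₁ sy = ⊥-elim (beyond-separates-nothing >-order yc k<i w e (swap⊎ sy))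
  ... | w , inj₂ sx = sx
  separation-across L k<i e s with separation-by-coordinate s
  ... | w , inj₁ sy = sy
  ... | w , inj₂ sx = ⊥-elim (beyond-separates-nothing >-order xc k<i w e (swap⊎ sx))
  separation-across R k<i e s with separation-by-coordinate s
  ... | w , inj₁ sy = sy
  ... | w , inj₂ sx = ⊥-elim (beyond-separates-nothing <-order xc k<i w e sx)

  separates-twice : ∀ {c k i i₂} → k <ᶠ i → NotFirst k →
    SeparatesAcross c k i → SeparatesAcross c i i₂ → ⊥
  separates-twice {c} k<i w (inj₁ s) (inj₁ s₂) = separates-twice-same <-order c k<i s s₂
  separates-twice {c} k<i w (inj₂ s) (inj₂ s₂) = separates-twice-same >-order c k<i s s₂
  separates-twice {c} k<i w (inj₁ s) (inj₂ s₂) = separates-twice-opposite <-order c k<i w s s₂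
  separates-twice {c} k<i w (inj₂ s) (inj₁ s₂) = separates-twice-opposite >-order c k<i w s s₂

  direction-code : ∀ {k i y} → Code r k i (dir y) → Separates r k i × Extreme i y
  direction-code (cU s e) = s , e
  direction-code (cD s e) = s , e
  direction-code (cL s e) = s , e
  direction-code (cR s e) = s , e

  directions-turn : ∀ {k i i₂ y z} → k <ᶠ i → i <ᶠ i₂ →
    Code r k i (dir y) → Code r i i₂ (dir z) → Turn y z
  directions-turn {y = y} {z} k<i i<i₂ cy cz with turn-or-parallel y z
  ... | inj₁ yz = yz
  ... | inj₂ same-axis with (s , e) ← direction-code cy | (s₂ , e₂) ← direction-code cz =
    ⊥-elim (separates-twice {across z} k<i (proj₁ s)
             (subst (λ c → SeparatesAcross c _ _) same-axis (separation-across y k<i e s))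
             (separation-across z i<i₂ e₂ s₂))

  extreme-after-turn : ∀ {x y J i} → Turn x y → NotFirst J → Extreme J x →
    SeparatesAcross (across y) J i → ∀ t → t <ᶠ J → toward x (along x (r t)) (along x (r i))
  extreme-after-turn (vh up left)     w e s = beyond-after-separation <-order yc w e s
  extreme-after-turn (vh up right)    w e s = beyond-after-separation <-order yc w e s
  extreme-after-turn (vh down left)   w e s = beyond-after-separation >-order yc w e (swap⊎ s)
  extreme-after-turn (vh down right)  w e s = beyond-after-separation >-order yc w e (swap⊎ s)
  extreme-after-turn (hv left up)     w e s = beyond-after-separation >-order xc w e (swap⊎ s)
  extreme-after-turn (hv left down)   w e s = beyond-after-separation >-order xc w e (swap⊎ s)
  extreme-after-turn (hv right up)    w e s = beyond-after-separation <-order xc w e s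
  extreme-after-turn (hv right down)  w e s = beyond-after-separation <-order xc w e s

  quadrant-code : ∀ {k i x y} → Turn x y → Extreme i x → Extreme i y →
                  Code r k i (num (quadrant x y))
  quadrant-code (vh up left)    ex ey = c2 (inj₁ ex , inj₂ ey) ey ex
  quadrant-code (vh up right)   ex ey = c1 (inj₁ ex , inj₁ ey) ey ex
  quadrant-code (vh down left)  ex ey = c3 (inj₂ ex , inj₂ ey) ey ex
  quadrant-code (vh down right) ex ey = c4 (inj₂ ex , inj₁ ey) ey ex
  quadrant-code (hv left up)    ex ey = c2 (inj₁ ey , inj₂ ex) ex ey
  quadrant-code (hv left down)  ex ey = c3 (inj₂ ey , inj₂ ex) ex ey
  quadrant-code (hv right up)   ex ey = c1 (inj₁ ey , inj₁ ex) ex ey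
  quadrant-code (hv right down) ex ey = c4 (inj₂ ey , inj₁ ex) ex ey

  numeral-extreme : ∀ {k i a} → Code r k i (num a) →
                    Extreme i (vertical a) × Extreme i (horizontal a)
  numeral-extreme (c1 _ eh ev) = ev , eh
  numeral-extreme (c2 _ eh ev) = ev , eh
  numeral-extreme (c3 _ eh ev) = ev , eh
  numeral-extreme (c4 _ eh ev) = ev , eh

  numeral-extreme-inner : ∀ {k i a} → Code r k i (num a) → ∀ y → Extreme i (inner a y)
  numeral-extreme-inner cd U = proj₂ (numeral-extreme cd)
  numeral-extreme-inner cd D = proj₂ (numeral-extreme cd)
  numeral-extreme-inner cd L = proj₁ (numeral-extreme cd)
  numeral-extreme-inner cd R = proj₁ (numeral-extreme cd)

  numeral-code-anyPrevious : ∀ {k k₂ i a} → Code r k i (num a) → Code r k₂ i (num a)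
  numeral-code-anyPrevious (c1 sn eh ev) = c1 sn eh ev
  numeral-code-anyPrevious (c2 sn eh ev) = c2 sn eh ev
  numeral-code-anyPrevious (c3 sn eh ev) = c3 sn eh ev
  numeral-code-anyPrevious (c4 sn eh ev) = c4 sn eh ev

  outside-extreme : ∀ {i} → OutsideBox r i → Σ Dir (Extreme i)
  outside-extreme (inj₁ e)               = R , e
  outside-extreme (inj₂ (inj₁ e))        = L , e
  outside-extreme (inj₂ (inj₂ (inj₁ e))) = U , e
  outside-extreme (inj₂ (inj₂ (inj₂ e))) = D , e

-- Reindexing a point sequence r along a strictly increasing index map g
-- (r' = r ∘ g up to pointwise equality) preserves all order-defined
-- notions, except that a point may lose the earlier points it separated.
module Reindex {M N : ℕ} (r : Fin N → Point) (g : Fin M → Fin N)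
               (g-mono : ∀ {a b} → a <ᶠ b → g a <ᶠ g b)
               (r' : Fin M → Point) (r'≗ : ∀ t → r' t ≡ r (g t)) where

  transport : ∀ (P : Point → Point → Set) {a b} → P (r (g a)) (r (g b)) → P (r' a) (r' b)
  transport P {a} {b} = subst₂ P (sym (r'≗ a)) (sym (r'≗ b))

  beyond : ∀ c ≺ i → Beyond r c ≺ (g i) → Beyond r' c ≺ i
  beyond c ≺ i e j j<i = transport (λ p q → ≺ (c p) (c q)) (e (g j) (g-mono j<i))

  separatesAlong : ∀ c ≺ k i → SeparatesAlong r c ≺ (g k) (g i) → SeparatesAlong r' c ≺ k i
  separatesAlong c ≺ k i (k≺i , i≺) =
    transport (λ p q → ≺ (c p) (c q)) k≺i ,
    λ j j<k → transport (λ p q → ≺ (c p) (c q)) (i≺ (g j) (g-mono j<k))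

  separates : ∀ {k i} → NotFirst r' k → Separates r (g k) (g i) → Separates r' k i
  separates {k} {i} w (_ , s) =
    w , map⊎ (separatesAlong yc _<ℤ_ k i)
         (map⊎ (separatesAlong yc (flip _<ℤ_) k i)
           (map⊎ (separatesAlong xc _<ℤ_ k i) (separatesAlong xc (flip _<ℤ_) k i))) s

  extreme : ∀ i d → Extreme r (g i) d → Extreme r' i d
  extreme i d = beyond (along d) (toward d) i

  separatesNothing : ∀ i → SeparatesNothing r (g i) → SeparatesNothing r' i
  separatesNothing i (v , h) =
    map⊎ (extreme i U) (extreme i D) v , map⊎ (extreme i R) (extreme i L) h

  outsideBox : ∀ i → OutsideBox r (g i) → OutsideBox r' i
  outsideBox i = map⊎ (extreme i R) (map⊎ (extreme i L) (map⊎ (extreme i U) (extreme i D)))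

  code : ∀ {k i ℓ} → (NotFirst r (g k) → NotFirst r' k) →
         Code r (g k) (g i) ℓ → Code r' k i ℓ
  code {i = i} nf (cU s e) = cU (separates (nf (proj₁ s)) s) (extreme i U e)
  code {i = i} nf (cD s e) = cD (separates (nf (proj₁ s)) s) (extreme i D e)
  code {i = i} nf (cL s e) = cL (separates (nf (proj₁ s)) s) (extreme i L e)
  code {i = i} nf (cR s e) = cR (separates (nf (proj₁ s)) s) (extreme i R e)
  code {i = i} _ (c1 sn eh ev) = c1 (separatesNothing i sn) (extreme i R eh) (extreme i U ev)
  code {i = i} _ (c2 sn eh ev) = c2 (separatesNothing i sn) (extreme i L eh) (extreme i U ev)
  code {i = i} _ (c3 sn eh ev) = c3 (separatesNothing i sn) (extreme i L eh) (extreme i D ev)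
  code {i = i} _ (c4 sn eh ev) = c4 (separatesNothing i sn) (extreme i R eh) (extreme i D ev)

  g-injective : ∀ {a b} → g a ≡ g b → a ≡ b
  g-injective {a} {b} ga≡gb with FP.<-cmp a b
  ... | tri< a<b _ _ = ⊥-elim (FP.<-irrefl ga≡gb (g-mono a<b))
  ... | tri≈ _ a≡b _ = a≡b
  ... | tri> _ _ b<a = ⊥-elim (FP.<-irrefl (sym ga≡gb) (g-mono b<a))

  distinct : Distinct r → Distinct r'
  distinct d i j i≢j = transport (λ p q → (xc p ≢ xc q) × (yc p ≢ yc q))
                                 (d (g i) (g j) (i≢j ∘ g-injective))

-- In a sequence of distinct points, the second point separates nothing,
-- since there is a single earlier point.
module _ {m : ℕ} (r : Fin m → Point) where

  only-earlier : ∀ {k i : Fin m} → toℕ k ≡ 0 → toℕ i ≡ 1 → ∀ j → j <ᶠ i → j ≡ k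
  only-earlier k≡0 i≡1 j j<i =
    FP.toℕ-injective (trans (ℕP.n<1⇒n≡0 (subst (toℕ j ℕ.<_) i≡1 j<i)) (sym k≡0))

  beyond-single : ∀ c k i → toℕ k ≡ 0 → toℕ i ≡ 1 → c (r k) ≢ c (r i) →
    Beyond r c _<ℤ_ i ⊎ Beyond r c (flip _<ℤ_) i
  beyond-single c k i k≡0 i≡1 k≢i with ℤP.<-cmp (c (r k)) (c (r i))
  ... | tri< k<i _ _ =
    inj₁ λ j j<i → subst (λ j → c (r j) <ℤ c (r i)) (sym (only-earlier k≡0 i≡1 j j<i)) k<i
  ... | tri≈ _ k≡i _ = ⊥-elim (k≢i k≡i)
  ... | tri> _ _ i<k =
    inj₂ λ j j<i → subst (λ j → c (r i) <ℤ c (r j)) (sym (only-earlier k≡0 i≡1 j j<i)) i<k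

  second-separatesNothing : Distinct r → ∀ k i → toℕ k ≡ 0 → toℕ i ≡ 1 → SeparatesNothing r i
  second-separatesNothing d k i k≡0 i≡1 =
    beyond-single yc k i k≡0 i≡1 (proj₂ distinct-ki) ,
    beyond-single xc k i k≡0 i≡1 (proj₁ distinct-ki)
    where
    distinct-ki = d k i (λ k≡i → ℕP.0≢1+n (trans (sym k≡0) (trans (cong toℕ k≡i) i≡1)))

punchIn-mono : ∀ {n} (J : Fin (suc n)) {a b : Fin n} → a <ᶠ b → punchIn J a <ᶠ punchIn J b
punchIn-mono zero    a<b = s≤s a<b
punchIn-mono (suc J) {zero}  {suc b} _         = s≤s z≤n
punchIn-mono (suc J) {suc a} {suc b} (s≤s a<b) = s≤s (punchIn-mono J a<b)

toℕ-punchIn-below : ∀ {n} (J : Fin (suc n)) t → toℕ t ℕ.< toℕ J → toℕ (punchIn J t) ≡ toℕ t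
toℕ-punchIn-below (suc J) zero    _         = refl
toℕ-punchIn-below (suc J) (suc t) (s≤s t<J) = cong suc (toℕ-punchIn-below J t t<J)

toℕ-punchIn-above : ∀ {n} (J : Fin (suc n)) t → toℕ J ℕ.≤ toℕ t →
                    toℕ (punchIn J t) ≡ suc (toℕ t)
toℕ-punchIn-above zero    t       _         = refl
toℕ-punchIn-above (suc J) (suc t) (s≤s J≤t) = cong suc (toℕ-punchIn-above J t J≤t)

punchIn-inject : ∀ {n} (j : Fin (suc n)) (t : Fin n) → toℕ t ≢ toℕ j →
                 punchIn (suc j) (inject₁ t) ≡ inject₁ (punchIn j t)
punchIn-inject zero    zero    t≢j = ⊥-elim (t≢j refl)
punchIn-inject zero    (suc t) _   = refl
punchIn-inject (suc j) zero    _   = refl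
punchIn-inject (suc j) (suc t) t≢j = cong suc (punchIn-inject j t (t≢j ∘ cong suc))

-- Consecutive pairs of
-- r' are consecutive in r, except for the pair around the gap, whose
-- second point now separates nothing.
module DeletePoint {M : ℕ} (r : Fin (suc M) → Point) (J : Fin (suc M))
                   (r' : Fin M → Point) (r'≗ : ∀ t → r' t ≡ r (punchIn J t)) where

  open Reindex r (punchIn J) (punchIn-mono J) r' r'≗ public

  AfterGap : Fin M → Set
  AfterGap i' = toℕ i' ≡ toℕ J

  afterGap-index : ∀ {i'} → AfterGap i' → toℕ (punchIn J i') ≡ suc (toℕ J)
  afterGap-index gap = trans (toℕ-punchIn-above J _ (ℕP.≤-reflexive (sym gap))) (cong suc gap)

  beyond-afterGap : ∀ c ≺ i' → AfterGap i' →
    (∀ t → t <ᶠ J → ≺ (c (r t)) (c (r (punchIn J i')))) → Beyond r' c ≺ i'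
  beyond-afterGap c ≺ i' gap e j' j'<i' =
    transport (λ p q → ≺ (c p) (c q)) (e (punchIn J j') before-gap)
    where
    j'<J : toℕ j' ℕ.< toℕ J
    j'<J = subst (toℕ j' ℕ.<_) gap j'<i'
    before-gap : punchIn J j' <ᶠ J
    before-gap = subst (ℕ._< toℕ J) (sym (toℕ-punchIn-below J j' j'<J)) j'<J

  separatesAcross-afterGap : ∀ {c i'} → AfterGap i' → SeparatesAcross r c J (punchIn J i') →
    Beyond r' c _<ℤ_ i' ⊎ Beyond r' c (flip _<ℤ_) i'
  separatesAcross-afterGap {c} {i'} gap (inj₁ (_ , before)) =
    inj₂ (beyond-afterGap c (flip _<ℤ_) i' gap before)
  separatesAcross-afterGap {c} {i'} gap (inj₂ (_ , before)) =
    inj₁ (beyond-afterGap c _<ℤ_ i' gap before)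

  separatesNothing-afterGap : ∀ {i'} → AfterGap i' → OutsideBox r (punchIn J i') →
    Separates r J (punchIn J i') → SeparatesNothing r' i'
  separatesNothing-afterGap {i'} gap out s =
    by-direction (proj₁ (outside-extreme r out)) (proj₂ (outside-extreme r out))
    where
    J<i' : J <ᶠ punchIn J i'
    J<i' = subst (toℕ J ℕ.<_) (sym (afterGap-index gap)) (ℕP.n<1+n (toℕ J))
    across-gap : ∀ d → Extreme r (punchIn J i') d →
                 Beyond r' (across d) _<ℤ_ i' ⊎ Beyond r' (across d) (flip _<ℤ_) i'
    across-gap d e = separatesAcross-afterGap {across d} gap (separation-across r d J<i' e s)
    by-direction : ∀ d → Extreme r (punchIn J i') d → SeparatesNothing r' i'
    by-direction U e = inj₁ (extreme i' U e) , across-gap U e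
    by-direction D e = inj₂ (extreme i' D e) , across-gap D e
    by-direction L e = across-gap L e , inj₂ (extreme i' L e)
    by-direction R e = across-gap R e , inj₁ (extreme i' R e)

  data ConsecutivePair (k' i' : Fin M) : Set where
    consecutive : toℕ (punchIn J i') ≡ suc (toℕ (punchIn J k')) → ConsecutivePair k' i'
    afterGap    : AfterGap i' → ConsecutivePair k' i'

  consecutivePair : ∀ k' i' → toℕ i' ≡ suc (toℕ k') → ConsecutivePair k' i'
  consecutivePair k' i' i'≡1+k' with toℕ k' ℕP.<? toℕ J
  ... | no k'≮J = consecutive (begin
    toℕ (punchIn J i')   ≡⟨ toℕ-punchIn-above J i' J≤i' ⟩
    suc (toℕ i')         ≡⟨ cong suc i'≡1+k' ⟩
    suc (suc (toℕ k'))   ≡⟨ cong suc (toℕ-punchIn-above J k' J≤k') ⟨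
    suc (toℕ (punchIn J k')) ∎)
    where
    open ≡-Reasoning
    J≤k' = ℕP.≮⇒≥ k'≮J
    J≤i' = ℕP.≤-trans J≤k' (subst (toℕ k' ℕ.≤_) (sym i'≡1+k') (ℕP.n≤1+n (toℕ k')))
  ... | yes k'<J with toℕ i' ℕP.<? toℕ J
  ...   | yes i'<J = consecutive (begin
    toℕ (punchIn J i')   ≡⟨ toℕ-punchIn-below J i' i'<J ⟩
    toℕ i'               ≡⟨ i'≡1+k' ⟩
    suc (toℕ k')         ≡⟨ cong suc (toℕ-punchIn-below J k' k'<J) ⟨
    suc (toℕ (punchIn J k')) ∎)
    where open ≡-Reasoning
  ...   | no i'≮J = afterGap (ℕP.≤-antisym (subst (ℕ._≤ toℕ J) (sym i'≡1+k') k'<J) (ℕP.≮⇒≥ i'≮J))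

  notFirst : ∀ k' → toℕ k' ≢ 0 → NotFirst r' k'
  notFirst zero     k'≢0 = ⊥-elim (k'≢0 refl)
  notFirst (suc k') _    = zero , s≤s z≤n

  pinConditions : PinConditions r → PinConditions r'
  pinConditions (d , pins) = distinct d , pair
    where
    pair : ∀ k' i' → toℕ i' ≡ suc (toℕ k') →
           OutsideBox r' i' × (Separates r' k' i' ⊎ SeparatesNothing r' i')
    pair k' i' i'≡1+k' with consecutivePair k' i' i'≡1+k'
    ... | afterGap gap with pins J (punchIn J i') (afterGap-index gap)
    ...   | out , inj₁ s  = outsideBox i' out , inj₂ (separatesNothing-afterGap gap out s)
    ...   | out , inj₂ sn = outsideBox i' out , inj₂ (separatesNothing i' sn)
    pair k' i' i'≡1+k' | consecutive c with pins (punchIn J k') (punchIn J i') c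
    ...   | out , inj₂ sn = outsideBox i' out , inj₂ (separatesNothing i' sn)
    ...   | out , inj₁ s with toℕ k' ℕ.≟ 0
    ...     | yes k'≡0 = outsideBox i' out , inj₂ (second-separatesNothing r' (distinct d) k' i'
                                                    k'≡0 (trans i'≡1+k' (cong suc k'≡0)))
    ...     | no  k'≢0 = outsideBox i' out , inj₁ (separates (notFirst k' k'≢0) s)

TurnsIntoNext : Letter → Maybe Letter → Set
TurnsIntoNext (dir y) next = TurnsInto y next
TurnsIntoNext (num _) _    = ⊤

Successive : ∀ {n} → Fin n → Fin n → Set
Successive s s₂ = toℕ s₂ ≡ suc (toℕ s)

inject-successive : ∀ {n} {s s₂ : Fin (suc n)} → Successive s s₂ → inject₁ s₂ ≡ suc s
inject-successive {s₂ = s₂} succ = FP.toℕ-injective (trans (FP.toℕ-inject₁ s₂) succ)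

inject<suc : ∀ {n} (s : Fin (suc n)) → inject₁ s <ᶠ suc s
inject<suc s = s≤s (ℕP.≤-reflexive (FP.toℕ-inject₁ s))

suc<suc : ∀ {n} {s s₂ : Fin n} → Successive s s₂ → suc s <ᶠ suc s₂
suc<suc succ = s≤s (ℕP.≤-reflexive (sym succ))

module DeleteFromPinWord {m : ℕ} (p : Fin (suc m) → Point) (p₀ : Point)
  (ℓ : Fin (suc m) → Letter)
  (codes : ∀ t → Code (withOrigin p₀ p) (inject₁ t) (suc t) (ℓ t))
  (j : Fin (suc m)) where

  r : Fin (suc (suc m)) → Point
  r = withOrigin p₀ p

  p' : Fin m → Point
  p' = p ∘ punchIn j

  r' : Fin (suc m) → Point
  r' = withOrigin p₀ p'

  r'≗ : ∀ t → r' t ≡ r (punchIn (suc j) t)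
  r'≗ zero    = refl
  r'≗ (suc t) = refl

  open DeletePoint r (suc j) r' r'≗ public

  ℓ' : Fin m → Letter
  ℓ' = replaceAt ℓ j (merged (ℓ j) (letterAt ℓ (suc (toℕ j))))

  letterAt-successive : ∀ {s s₂} → Successive s s₂ → letterAt ℓ (suc (toℕ s)) ≡ just (ℓ s₂)
  letterAt-successive {s} {s₂} succ = trans (cong (letterAt ℓ) (sym succ)) (letterAt-lookup ℓ s₂)

  code-successive : ∀ {s s₂} → Successive s s₂ → Code r (suc s) (suc s₂) (ℓ s₂)
  code-successive {s} {s₂} succ =
    subst (λ k → Code r k (suc s₂) (ℓ s₂)) (inject-successive succ) (codes s₂)

  turns-into-next : ∀ s → TurnsIntoNext (ℓ s) (letterAt ℓ (suc (toℕ s)))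
  turns-into-next s with position? {suc m} (suc (toℕ s))
  ... | inj₂ beyond rewrite letterAt-beyond ℓ _ beyond with ℓ s
  ...   | dir _ = tt
  ...   | num _ = tt
  turns-into-next s | inj₁ (s₂ , succ) rewrite letterAt-successive succ
    with ℓ s | codes s | ℓ s₂ | code-successive succ
  ... | num _ | _  | _     | _  = tt
  ... | dir _ | _  | num _ | _  = tt
  ... | dir _ | cy | dir _ | cz = directions-turn r (inject<suc s) (suc<suc succ) cy cz

  mergeable-successive : ∀ {j₁} → Successive j j₁ →
                         Mergeable (ℓ j) (just (ℓ j₁)) (letterAt ℓ (suc (toℕ j₁)))
  mergeable-successive {j₁} succ
    with ℓ j | codes j | ℓ j₁ | code-successive succ | turns-into-next j₁
  ... | _     | _  | num _ | _  | _    = tt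
  ... | num _ | _  | dir _ | _  | next = next
  ... | dir _ | cx | dir _ | cy | next =
    directions-turn r (inject<suc j) (suc<suc succ) cx cy , next

  mergeable : Mergeable (ℓ j) (letterAt ℓ (suc (toℕ j))) (letterAt ℓ (suc (suc (toℕ j))))
  mergeable with position? {suc m} (suc (toℕ j))
  ... | inj₂ beyond rewrite letterAt-beyond ℓ _ beyond = tt
  ... | inj₁ (j₁ , succ) =
    subst₂ (Mergeable (ℓ j)) (sym (letterAt-successive succ)) (cong (λ n → letterAt ℓ (suc n)) succ)
           (mergeable-successive succ)

  notFirst-inject : ∀ t → NotFirst r (punchIn (suc j) (inject₁ t)) → NotFirst r' (inject₁ t)
  notFirst-inject zero    (_ , ())
  notFirst-inject (suc t) _ = zero , s≤s z≤n

  code-kept : ∀ t → toℕ t ≢ toℕ j → Code r' (inject₁ t) (suc t) (ℓ (punchIn j t))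
  code-kept t t≢j = code (notFirst-inject t)
    (subst (λ k → Code r k (suc (punchIn j t)) (ℓ (punchIn j t))) (sym (punchIn-inject j t t≢j))
           (codes (punchIn j t)))

  -- After the gap, the point formerly coded by the direction y, following
  -- a point extreme in a direction x turning into y, now lies in the
  -- quadrant of x and y.
  module AfterTheGap (t : Fin m) (t≡j : toℕ t ≡ toℕ j) where

    j₁ : Fin (suc m)
    j₁ = punchIn j t

    succ : Successive j j₁
    succ = trans (toℕ-punchIn-above j t (ℕP.≤-reflexive (sym t≡j))) (cong suc t≡j)

    gap : AfterGap (suc t)
    gap = cong suc t≡j

    quadrant-afterGap : ∀ {x y} → Turn x y → Extreme r (suc j) x → Code r (suc j) (suc j₁) (dir y) →
                        Code r' (inject₁ t) (suc t) (num (quadrant x y))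
    quadrant-afterGap {x} {y} xy ex cy with (s , ey) ← direction-code r cy =
      quadrant-code r' xy
        (beyond-afterGap (along x) (toward x) (suc t) gap
          (extreme-after-turn r xy (zero , s≤s z≤n) ex (separation-across r y j<j₁ ey s)))
        (extreme (suc t) y ey)
      where
      j<j₁ : suc j <ᶠ suc j₁
      j<j₁ = suc<suc succ

    code-merged : Code r' (inject₁ t) (suc t) (merged (ℓ j) (just (ℓ j₁)))
    code-merged with ℓ j | codes j | ℓ j₁ | code-successive succ
    ... | _     | _  | num a | ca = code (notFirst-inject t) (numeral-code-anyPrevious r ca)
    ... | dir x | cx | dir y | cy =
      quadrant-afterGap (directions-turn r (inject<suc j) (suc<suc succ) cx cy)
                        (proj₂ (direction-code r cx)) cy
    ... | num a | ca | dir y | cy = quadrant-afterGap (inner-turn a y) (numeral-extreme-inner r ca y) cy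

  codes' : ∀ t → Code r' (inject₁ t) (suc t) (ℓ' t)
  codes' t with toℕ t ℕ.≟ toℕ j
  ... | no  t≢j = subst (Code r' _ _) (sym (replaceAt-elsewhere ℓ j _ t t≢j)) (code-kept t t≢j)
  ... | yes t≡j = subst (Code r' _ _) (sym new-letter) code-merged
    where
    open AfterTheGap t t≡j
    new-letter : ℓ' t ≡ merged (ℓ j) (just (ℓ j₁))
    new-letter = trans (replaceAt-at ℓ j _ t t≡j) (cong (merged (ℓ j)) (letterAt-successive succ))

  -- A pin word starts with a numeral: the first point separates nothing.
  numeralLed : NumeralLed (tabulate ℓ)
  numeralLed with ℓ zero | codes zero
  ... | num _ | _  = tt
  ... | dir _ | cd with proj₁ (proj₁ (direction-code r cd))
  ...   | _ , ()

  language : ∀ w → InL (tabulate ℓ) w → InL (tabulate ℓ') w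
  language = deletion-sound (deletion-at ℓ j mergeable) numeralLed

-- An injective endomap of Fin n is onto (otherwise punching out a missed
-- value would inject Fin (suc n) into Fin n).
injective-onto : ∀ {n} (f : Fin n → Fin n) → (∀ {a b} → f a ≡ f b → a ≡ b) →
                 ∀ y → Σ (Fin n) λ x → f x ≡ y
injective-onto {suc n} f f-inj y with FP.any? (λ x → f x FP.≟ y)
... | yes hit = hit
... | no  miss = ⊥-elim (ℕP.<-irrefl refl (FP.injective⇒≤ {f = g} g-inj))
  where
  y≢f : ∀ x → y ≢ f x
  y≢f x y≡fx = miss (x , sym y≡fx)
  g : Fin (suc n) → Fin n
  g x = punchOut (y≢f x)
  g-inj : ∀ {a b} → g a ≡ g b → a ≡ b
  g-inj ga≡gb = f-inj (FP.punchOut-injective (y≢f _) (y≢f _) ga≡gb)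

increasing-reflects : ∀ {k n} (ι : Fin k → Fin n) → (∀ a b → a <ᶠ b → ι a <ᶠ ι b) →
                      ∀ a b → ι a <ᶠ ι b → a <ᶠ b
increasing-reflects ι mono a b ιa<ιb with FP.<-cmp a b
... | tri< a<b _ _ = a<b
... | tri≈ _ refl _ = ⊥-elim (FP.<-irrefl refl ιa<ιb)
... | tri> _ _ b<a = ⊥-elim (FP.<-asym ιa<ιb (mono b a b<a))

-- Points P, Q are ordered like the diagram points (a, π a), (b, π b);
-- OrderIso p π is a map f with p s, p t ordered like f s, f t.
OrderedLike : ∀ {k} → Permutation′ k → Point → Point → Fin k → Fin k → Set
OrderedLike π P Q a b =
  ((xc P <ℤ xc Q → a <ᶠ b) × (a <ᶠ b → xc P <ℤ xc Q)) ×
  ((yc P <ℤ yc Q → π ⟨$⟩ʳ a <ᶠ π ⟨$⟩ʳ b) × (π ⟨$⟩ʳ a <ᶠ π ⟨$⟩ʳ b → yc P <ℤ yc Q))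

ordered-pattern : ∀ {k n} (π : Permutation′ k) (σ : Permutation′ n) →
  ((ι , _ , _) : π ≼ σ) → ∀ {P Q} a b → OrderedLike σ P Q (ι a) (ι b) → OrderedLike π P Q a b
ordered-pattern π σ (ι , mono , values) a b ((x⇒ , ⇒x) , (y⇒ , ⇒y)) =
  (increasing-reflects ι mono a b ∘ x⇒ , ⇒x ∘ mono a b) ,
  (proj₁ (values a b) ∘ y⇒ , ⇒y ∘ proj₂ (values a b))

orderIso-injective : ∀ {n} {p : Fin n → Point} {σ : Permutation′ n} → Distinct p →
  ((f , _) : OrderIso p σ) → ∀ {s t} → f s ≡ f t → s ≡ t
orderIso-injective {p = p} d (f , ordered) {s} {t} fs≡ft with s FP.≟ t
... | yes s≡t = s≡t
... | no  s≢t with ℤP.<-cmp (xc (p s)) (xc (p t))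
...   | tri< s<t _ _ = ⊥-elim (FP.<-irrefl fs≡ft (proj₁ (proj₁ (ordered s t)) s<t))
...   | tri≈ _ s≈t _ = ⊥-elim (proj₁ (d s t s≢t) s≈t)
...   | tri> _ _ t<s = ⊥-elim (FP.<-irrefl (sym fs≡ft) (proj₁ (proj₁ (ordered t s)) t<s))

toList-tabulate-lookup : ∀ {n} {A : Set} (u : Vec A n) → toList u ≡ tabulate (lookup u)
toList-tabulate-lookup Vec.[]       = refl
toList-tabulate-lookup (x Vec.∷ u) = cong (x ∷_) (toList-tabulate-lookup u)

toList-tabulate : ∀ {n} {A : Set} (f : Fin n → A) → toList (Vec.tabulate f) ≡ tabulate f
toList-tabulate {zero}  f = refl
toList-tabulate {suc n} f = cong (f zero ∷_) (toList-tabulate (f ∘ suc))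

-- A state of size M is a pin representation with origin
-- whose pin word ℓ has w ∈ 𝓛(ℓ) and which contains a copy of the diagram
-- of π.  Points outside the copy are deleted one at a time; when none is
-- left the state is a pin representation of π.
module Reduction {k : ℕ} (π : Permutation′ k) (w : List Dir) where

  record State (M : ℕ) : Set where
    field
      p              : Fin M → Point
      p₀             : Point
      ℓ              : Fin M → Letter
      pins           : PinConditions p
      pinsWithOrigin : PinConditions (withOrigin p₀ p)
      codes          : ∀ t → Code (withOrigin p₀ p) (inject₁ t) (suc t) (ℓ t)
      inLanguage     : InL (tabulate ℓ) w
      copy           : Fin k → Fin M
      copy-ordered   : ∀ a b → OrderedLike π (p (copy a)) (p (copy b)) a b

  open State

  -- The copy is injective: its points have distinct x-coordinates.
  copy-injective : ∀ {M} (st : State M) → ∀ {a b} → copy st a ≡ copy st b → a ≡ b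
  copy-injective st {a} {b} ha≡hb with FP.<-cmp a b
  ... | tri< a<b _ _ =
    ⊥-elim (ℤP.<-irrefl (cong (xc ∘ p st) ha≡hb) (proj₂ (proj₁ (copy-ordered st a b)) a<b))
  ... | tri≈ _ a≡b _ = a≡b
  ... | tri> _ _ b<a =
    ⊥-elim (ℤP.<-irrefl (cong (xc ∘ p st) (sym ha≡hb)) (proj₂ (proj₁ (copy-ordered st b a)) b<a))

  delete : ∀ {M} (st : State (suc M)) j → (∀ a → copy st a ≢ j) → State M
  delete {M} st j j∉copy = record
    { p              = Del.p'
    ; p₀             = p₀ st
    ; ℓ              = Del.ℓ'
    ; pins           = DeletePoint.pinConditions (p st) j Del.p' (λ _ → refl) (pins st)
    ; pinsWithOrigin = Del.pinConditions (pinsWithOrigin st)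
    ; codes          = Del.codes'
    ; inLanguage     = Del.language w (inLanguage st)
    ; copy           = copy'
    ; copy-ordered   = λ a b → subst₂ (λ P Q → OrderedLike π P Q a b)
                                 (sym (same-point a)) (sym (same-point b)) (copy-ordered st a b)
    }
    where
    module Del = DeleteFromPinWord (p st) (p₀ st) (ℓ st) (codes st) j
    j≢copy : ∀ a → j ≢ copy st a
    j≢copy a = j∉copy a ∘ sym
    copy' : Fin k → Fin M
    copy' a = punchOut (j≢copy a)
    same-point : ∀ a → Del.p' (copy' a) ≡ p st (copy st a)
    same-point a = cong (p st) (FP.punchIn-punchOut (j≢copy a))

  complete : ∀ {M} (st : State M) → (∀ t → Σ (Fin k) λ a → copy st a ≡ t) → InLπ π w
  complete {M} st onto = by-size (FP.cantor-schröder-bernstein (copy-injective st) g-inj) st onto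
    where
    g : Fin M → Fin k
    g t = proj₁ (onto t)
    g-inj : ∀ {s t} → g s ≡ g t → s ≡ t
    g-inj {s} {t} gs≡gt =
      trans (sym (proj₂ (onto s))) (trans (cong (copy st) gs≡gt) (proj₂ (onto t)))
    by-size : ∀ {M'} → k ≡ M' → (st : State M') → (∀ t → Σ (Fin k) λ a → copy st a ≡ t) → InLπ π w
    by-size refl st onto =
      Vec.tabulate (ℓ st) ,
      (p st , p₀ st , pins st , (f , ordered) , pinsWithOrigin st ,
       λ t → subst (Code _ _ _) (sym (VecP.lookup∘tabulate (ℓ st) t)) (codes st t)) ,
      subst (λ u → InL u w) (sym (toList-tabulate (ℓ st))) (inLanguage st)
      where
      f : Fin k → Fin k
      f t = proj₁ (onto t)
      ordered : ∀ s t → OrderedLike π (p st s) (p st t) (f s) (f t)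
      ordered s t = subst₂ (λ s t → OrderedLike π (p st s) (p st t) (f _) (f _))
                           (proj₂ (onto s)) (proj₂ (onto t)) (copy-ordered st (f s) (f t))

  reduce : ∀ M → State M → InLπ π w
  reduce M st with FP.any? (λ t → FP.all? (λ a → ¬? (copy st a FP.≟ t)))
  reduce (suc M) st | yes (j , j∉copy) = reduce M (delete st j j∉copy)
  reduce zero    st | yes (() , _)
  ... | no all-covered = complete st covered
    where
    covered : ∀ t → Σ (Fin k) λ a → copy st a ≡ t
    covered t with FP.any? (λ a → copy st a FP.≟ t)
    ... | yes hit  = hit
    ... | no  miss = ⊥-elim (all-covered (t , λ a ha≡t → miss (a , ha≡t)))

  initial : ∀ {n} (σ : Permutation′ n) → π ≼ σ → ∀ u → IsPinWord σ u → InL (toList u) w → State n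
  initial {n} σ embedding u (p , p₀ , pins , iso@(f , ordered) , pinsWithOrigin , codes) inL = record
    { p              = p
    ; p₀             = p₀
    ; ℓ              = lookup u
    ; pins           = pins
    ; pinsWithOrigin = pinsWithOrigin
    ; codes          = codes
    ; inLanguage     = subst (λ v → InL v w) (toList-tabulate-lookup u) inL
    ; copy           = copy₀
    ; copy-ordered   = λ a b → ordered-pattern π σ embedding a b
        (subst₂ (OrderedLike σ _ _) (f-copy a) (f-copy b) (ordered (copy₀ a) (copy₀ b)))
    }
    where
    index : ∀ y → Σ (Fin n) λ s → f s ≡ y
    index = injective-onto f (orderIso-injective {σ = σ} (proj₁ pins) iso)
    copy₀ : Fin k → Fin n
    copy₀ a = proj₁ (index (proj₁ embedding a))
    f-copy : ∀ a → f (copy₀ a) ≡ proj₁ embedding a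
    f-copy a = proj₂ (index (proj₁ embedding a))

theorem3p15 : ∀ {k n} (π : Permutation′ k) (σ : Permutation′ n) →
    π ≼ σ → ∀ (w : List Dir) → InLπ σ w → InLπ π w
theorem3p15 {n = n} π σ embedding w (u , pinWord , inL) =
  reduce n (initial σ embedding u pinWord inL)
  where open Reduction π w
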